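{- Let $X=X_0\cup\dots\cup X_d$ (with $X_0=\{x\}$) and the pattern set $Y$ be finite, $L=L(X|Y)$, and let $G$ be the grammar described in the context. Then $G$ is deterministic: every sentential form occurring in a rightmost derivation of a word of $L$ has a forced handle.
   Context: Labelled trees: planar rooted trees whose vertices other than the root carry labels from a finite set $X=X_0\cup\dots\cup X_d$ ($d>0$), where $X_i$ is the set of labels of vertices having exactly $i$ children; $X_0=\{x\}$ and vertices labelled $x$ are leaves called free ends. Trees are identified with their Polish-notation words over $X$ (label of the top vertex followed by the words of its children's subtrees from left to right; a free end is $x$; the word $x$ is the tree with a single free end). A tree avoids $Y$ if it contains no subtree isomorphic to an element of $Y$; $L=L(X|Y)$ is the set of trees avoiding $Y$. Height = maximal number of internal nodes on a branch; $D=\max\{\mathrm{height}(t):t\in Y\}$ ($D=0$ if $Y=\emptyset$); $L_D$ = trees of $L$ of height $\le D$. $t\sqsubseteq v$ means $v$ is obtained from $t$ by grafting trees onto free ends of $t$; $t\sqsubset v$ means also $t\ne v$. $\widehat{M_t}=\{v\in L:t\sqsubseteq v\}$, $M_t=\widehat{M_t}\setminus\bigcup_{s\in L_D,\,t\sqsubset s}\widehat{M_s}$. The grammar $G$ has terminals $X$, non-terminals $\{T_v:v\in L_D\}\cup\{S\}$, start symbol $S$, and rules: $T_v\to mT_{v_1}\cdots T_{v_k}$ for each $v\in L_D$ whose top label is $m\in X_k$, $k\ge1$, and all $v_1,\dots,v_k\in L_D$ with $mv_1\cdots v_k\in M_v$; $T_x\to x$; and $S\to T_v$ for all $v\in L_D$.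 In a rightmost derivation, a sentential form is written $a=uhq$ where $q$ is a word of terminals and $h$ is the handle, i.e. the right-hand side of the rule applied in the reverse (reduction) step producing the previous sentential form. The handle $h$ of $a=uhq$ is forced if for every word $q'$ of terminals and every sentential form of the shape $uhq'$ occurring in a rightmost derivation of a word of $L$, the handle of $uhq'$ is this same occurrence of $h$. -}

module Defs where

open import Data.Nat using (ℕ; zero; suc; _≤_; _⊔_)
open import Data.Fin using (Fin)
open import Data.Vec using (Vec; []; _∷_; lookup; toList)
open import Data.List using (List; []; _∷_; _++_; map; foldr)
open import Data.List.Membership.Propositional using (_∈_)
open import Data.Product using (Σ; _×_; ∃)
open import Relation.Nullary using (¬_)
open import Relation.Binary.PropositionalEquality using (_≡_; _≢_)
open import Relation.Binary.Construct.Closure.ReflexiveTransitive using (Star)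

-- Signature: the label set X = {x} ∪ Fin m, where the label i : Fin m has
-- arity ar i (number of children).  So X_k = {i | ar i ≡ k} for k ≥ 1.
module _ {m : ℕ} (ar : Fin m → ℕ) where

  -- Labelled planar rooted trees; 'leaf' is a free end (label x).
  data Tree : Set where
    leaf : Tree
    node : (f : Fin m) → Vec Tree (ar f) → Tree

  data Sym : Set where
    x   : Sym
    lab : Fin m → Sym

  mutual
    word : Tree → List Sym
    word leaf        = x ∷ []
    word (node f ts) = lab f ∷ words ts

    words : ∀ {n} → Vec Tree n → List Sym
    words []       = []
    words (t ∷ ts) = word t ++ words ts

  mutual
    height : Tree → ℕ
    height leaf        = 0
    height (node f ts) = suc (heights ts)

    heights : ∀ {n} → Vec Tree n → ℕ
    heights []       = 0
    heights (t ∷ ts) = height t ⊔ heights ts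

  -- t ⊑ v : v is obtained from t by grafting trees onto free ends of t.
  data _⊑_ : Tree → Tree → Set where
    leaf⊑ : ∀ {v} → leaf ⊑ v
    node⊑ : ∀ {f} {ts vs : Vec Tree (ar f)} →
            (∀ i → lookup ts i ⊑ lookup vs i) → node f ts ⊑ node f vs

  _⊏_ : Tree → Tree → Set
  t ⊏ v = t ⊑ v × t ≢ v

  data Occurs (s : Tree) : Tree → Set where
    here  : ∀ {t} → s ⊑ t → Occurs s t
    there : ∀ {f} {ts : Vec Tree (ar f)} (i : Fin (ar f)) →
            Occurs s (lookup ts i) → Occurs s (node f ts)

  module _ (Y : List Tree) where

    Avoids : Tree → Set
    Avoids t = ∀ s → s ∈ Y → ¬ Occurs s t

    D : ℕ
    D = foldr (λ s n → height s ⊔ n) 0 Y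

    InL : Tree → Set
    InL = Avoids

    InLD : Tree → Set
    InLD v = Avoids v × height v ≤ D

    InM : Tree → Tree → Set
    InM t v = InL v × t ⊑ v × (∀ s → InLD s → t ⊏ s → ¬ (s ⊑ v))

    WordInL : List Sym → Set
    WordInL w = Σ Tree λ t → InL t × word t ≡ w

    -- Non-terminals of G: S and T_v (only v ∈ L_D have rules / are reachable).
    data NT : Set where
      S : NT
      T : Tree → NT

    data GSym : Set where
      ter : Sym → GSym
      nt  : NT → GSym

    SF : Set
    SF = List GSym

    terms : List Sym → SF
    terms = map ter

    data Rule : NT → SF → Set where
      nodeRule : ∀ (f : Fin m) (ws vs : Vec Tree (ar f)) →
                 InLD (node f ws) → (∀ i → InLD (lookup vs i)) →
                 InM (node f ws) (node f vs) →
                 Rule (T (node f ws)) (ter (lab f) ∷ map (λ v → nt (T v)) (toList vs))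
      leafRule : InLD leaf → Rule (T leaf) (ter x ∷ [])
      startRule : ∀ v → InLD v → Rule S (nt (T v) ∷ [])

    data _⇒_ : SF → SF → Set where
      step : ∀ (u : SF) {A : NT} {h : SF} (q : List Sym) → Rule A h →
             (u ++ nt A ∷ terms q) ⇒ (u ++ h ++ terms q)

    _⇒*_ : SF → SF → Set
    _⇒*_ = Star _⇒_

    -- The sentential form u h q (q terminal) occurs in a rightmost derivation
    -- of a word of L, with handle this occurrence of h (i.e. it was produced
    -- from u A q by a rule A → h).
    HandleOcc : SF → SF → List Sym → Set
    HandleOcc u h q =
      Σ NT λ A → Σ (List Sym) λ w →
        WordInL w × ((nt S ∷ []) ⇒* (u ++ nt A ∷ terms q)) × Rule A h ×
        ((u ++ h ++ terms q) ⇒* terms w)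

    Forced : SF → SF → Set
    Forced u h =
      ∀ (q' : List Sym) (u₂ h₂ : SF) (q₂ : List Sym) →
        u₂ ++ h₂ ++ terms q₂ ≡ u ++ h ++ terms q' →
        HandleOcc u₂ h₂ q₂ → u₂ ≡ u × h₂ ≡ h

{-# OPTIONS --safe #-}
module Submission where

open import Defs
open import Data.Nat using (ℕ; _≤_; _<_; zero; suc)
open import Data.Fin using (Fin)
open import Data.List using (List; []; _∷_; _++_; map)
open import Data.List.Properties using (∷-injectiveˡ; ∷-injectiveʳ; ++-conicalʳ)
open import Data.List.Relation.Unary.All using (All; []; _∷_; universal)
open import Data.List.Relation.Unary.All.Properties using (++⁺; ++⁻ˡ; ++⁻ʳ; map⁺)
open import Data.Vec using (Vec; toList) renaming ([] to []ᵥ; _∷_ to _∷ᵥ_)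
open import Data.Product using (_×_; _,_; proj₁; map₁)
open import Data.Sum using (_⊎_; inj₁; inj₂)
open import Data.Unit using (⊤; tt)
open import Data.Empty using (⊥; ⊥-elim)
open import Relation.Nullary using (¬_)
open import Relation.Binary.PropositionalEquality using (_≡_; refl; sym; cong; cong₂)
open import Relation.Binary.Construct.Closure.ReflexiveTransitive using (ε; _◅_)

-- In a rightmost derivation the nonterminal rewritten is always the last one, so every
-- sentential form u A q has the following property: a terminal of arity k (x has arity 0)
-- that is immediately followed by k nonterminals has no nonterminal after them. The
-- right-hand side of a rule T_v → m T_{v_1} ⋯ T_{v_k} is exactly a terminal of arity k
-- followed by k nonterminals, and in u h q' it is followed by terminals only. Two such
-- occurrences in the same form would place the earlier one, with its k nonterminals,
-- before the nonterminal that the later one replaced, against the property. The start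
-- rules S → T_v apply only to the one-letter form S.

module _ {m : ℕ} {ar : Fin m → ℕ} {Y : List (Tree ar)} where

  IsTerminal : GSym ar Y → Set
  IsTerminal (ter _) = ⊤
  IsTerminal (nt _)  = ⊥

  IsNotStart : GSym ar Y → Set
  IsNotStart (nt S) = ⊥
  IsNotStart _      = ⊤

  arity : Sym ar → ℕ
  arity x       = 0
  arity (lab f) = ar f

  nonterminals : ∀ {n} → Vec (Tree ar) n → SF ar Y
  nonterminals vs = map (λ v → nt (T v)) (toList vs)

  rhs : (a : Sym ar) → Vec (Tree ar) (arity a) → SF ar Y
  rhs a vs = ter a ∷ nonterminals vs

  Follows : ℕ → SF ar Y → Set
  Follows zero    r            = All IsTerminal r
  Follows (suc k) (nt _ ∷ r)   = Follows k r
  Follows (suc k) (ter _ ∷ _)  = ⊤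
  Follows (suc k) []           = ⊤

  Rightmost : SF ar Y → Set
  Rightmost []          = ⊤
  Rightmost (ter a ∷ r) = Follows (arity a) r × Rightmost r
  Rightmost (nt _ ∷ r)  = Rightmost r

  record Derived (l : SF ar Y) : Set where
    constructor derived
    field
      no-start   : All IsNotStart l
      -- a form starting with a nonterminal is that nonterminal alone
      head-alone : Follows 1 l
      rightmost  : Rightmost l

  RightmostForm : SF ar Y → Set
  RightmostForm l = l ≡ nt S ∷ [] ⊎ Derived l

  data Handle : NT ar Y → SF ar Y → Set where
    start : ∀ v → Handle S (nt (T v) ∷ [])
    grow  : ∀ w a (vs : Vec (Tree ar) (arity a)) → Handle (T w) (rhs a vs)

  handle : ∀ {A h} → Rule ar Y A h → Handle A h
  handle (nodeRule f ws vs _ _ _) = grow (node f ws) (lab f) vs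
  handle (leafRule _)             = grow leaf x []ᵥ
  handle (startRule v _)          = start v

  all-terms : ∀ {P : GSym ar Y → Set} → (∀ a → P (ter a)) → ∀ q → All P (terms ar Y q)
  all-terms p q = map⁺ (universal p q)

  ¬terminal-++-nt : ∀ u {A r} → ¬ All IsTerminal (u ++ nt A ∷ r)
  ¬terminal-++-nt u p with ++⁻ʳ u p
  ... | () ∷ _

  ¬notStart-++-S : ∀ u {r} → ¬ All IsNotStart (u ++ nt S ∷ r)
  ¬notStart-++-S u p with ++⁻ʳ u p
  ... | () ∷ _

  follows-terminal : ∀ k {r} → All IsTerminal r → Follows k r
  follows-terminal zero    p                     = p
  follows-terminal (suc k) []                    = tt
  follows-terminal (suc k) {ter _ ∷ _} (_ ∷ _)   = tt

  follows-nonterminals : ∀ {n} (vs : Vec (Tree ar) n) {r} →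
                         All IsTerminal r → Follows n (nonterminals vs ++ r)
  follows-nonterminals []ᵥ       p = p
  follows-nonterminals (_ ∷ᵥ vs) p = follows-nonterminals vs p

  follows-replace : ∀ k u {A r a s} → Follows k (u ++ nt A ∷ r) → Follows k (u ++ ter a ∷ s)
  follows-replace zero    u            p = ⊥-elim (¬terminal-++-nt u p)
  follows-replace (suc k) []           p = tt
  follows-replace (suc k) (nt _ ∷ u)   p = follows-replace k u p
  follows-replace (suc k) (ter _ ∷ u)  p = tt

  nonterminals-notStart : ∀ {n} (vs : Vec (Tree ar) n) → All IsNotStart (nonterminals vs)
  nonterminals-notStart []ᵥ       = []
  nonterminals-notStart (_ ∷ᵥ vs) = tt ∷ nonterminals-notStart vs

  rightmost-terminal : ∀ {r} → All IsTerminal r → Rightmost r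
  rightmost-terminal []                  = tt
  rightmost-terminal {ter a ∷ _} (_ ∷ p) = follows-terminal (arity a) p , rightmost-terminal p

  rightmost-nonterminals : ∀ {n} (vs : Vec (Tree ar) n) {r} →
                           Rightmost r → Rightmost (nonterminals vs ++ r)
  rightmost-nonterminals []ᵥ       p = p
  rightmost-nonterminals (_ ∷ᵥ vs) p = rightmost-nonterminals vs p

  rightmost-tail : ∀ c {l} → Rightmost (c ∷ l) → Rightmost l
  rightmost-tail (ter _) (_ , p) = p
  rightmost-tail (nt _)  p       = p

  rightmost-grow : ∀ u {A a q} (vs : Vec (Tree ar) (arity a)) →
                   Rightmost (u ++ nt A ∷ terms ar Y q) → Rightmost (u ++ rhs a vs ++ terms ar Y q)
  rightmost-grow []          {q = q} vs _ =
    follows-nonterminals vs q-terminal , rightmost-nonterminals vs (rightmost-terminal q-terminal)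
    where q-terminal = all-terms (λ _ → tt) q
  rightmost-grow (ter b ∷ u) vs (f , p) = follows-replace (arity b) u f , rightmost-grow u vs p
  rightmost-grow (nt _ ∷ u)  vs p       = rightmost-grow u vs p

  start-form : ∀ u {q} → RightmostForm (u ++ nt S ∷ terms ar Y q) → u ≡ [] × q ≡ []
  start-form []      {[]}    _                = refl , refl
  start-form []      {_ ∷ _} (inj₁ ())
  start-form (_ ∷ u)         (inj₁ e)         with ++-conicalʳ u _ (∷-injectiveʳ e)
  ... | ()
  start-form u               (inj₂ d)         = ⊥-elim (¬notStart-++-S u (Derived.no-start d))

  derived-T : ∀ u {w r} → RightmostForm (u ++ nt (T w) ∷ r) → Derived (u ++ nt (T w) ∷ r)
  derived-T []      (inj₁ ())
  derived-T (_ ∷ u) (inj₁ e) with ++-conicalʳ u _ (∷-injectiveʳ e)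
  ... | ()
  derived-T u       (inj₂ d) = d

  derived-grow : ∀ u {w a q} (vs : Vec (Tree ar) (arity a)) →
                 Derived (u ++ nt (T w) ∷ terms ar Y q) → Derived (u ++ rhs a vs ++ terms ar Y q)
  derived-grow u {q = q} vs (derived notStart f r) =
    derived (++⁺ (++⁻ˡ u notStart) (tt ∷ ++⁺ (nonterminals-notStart vs) (all-terms (λ _ → tt) q)))
            (follows-replace 1 u f)
            (rightmost-grow u vs r)

  rightmostForm-step : ∀ {l l′} → RightmostForm l → _⇒_ ar Y l l′ → RightmostForm l′
  rightmostForm-step p (step u q rule) with handle rule
  ... | start v with start-form u p
  ...   | refl , refl = inj₂ (derived (tt ∷ []) [] tt)
  rightmostForm-step p (step u q rule) | grow _ _ vs = inj₂ (derived-grow u vs (derived-T u p))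

  rightmostForm-reachable : ∀ {l} → _⇒*_ ar Y (nt S ∷ []) l → RightmostForm l
  rightmostForm-reachable = go (inj₁ refl)
    where
    go : ∀ {l l′} → RightmostForm l → _⇒*_ ar Y l l′ → RightmostForm l′
    go p ε        = p
    go p (s ◅ ss) = go (rightmostForm-step p s) ss

  nonterminals-then-terminal : ∀ {k} (vs : Vec (Tree ar) k) u {A r s b s′} →
                               Follows k (u ++ nt A ∷ r) → ¬ nonterminals vs ++ s ≡ u ++ ter b ∷ s′
  nonterminals-then-terminal []ᵥ       u           f _ = ¬terminal-++-nt u f
  nonterminals-then-terminal (_ ∷ᵥ vs) []          f ()
  nonterminals-then-terminal (_ ∷ᵥ vs) (ter _ ∷ u) f ()
  nonterminals-then-terminal (_ ∷ᵥ vs) (nt _ ∷ u)  f e =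
    nonterminals-then-terminal vs u f (∷-injectiveʳ e)

  nonterminals-prefix : ∀ {n} (vs vs₂ : Vec (Tree ar) n) {s s₂} →
                        nonterminals vs ++ s ≡ nonterminals vs₂ ++ s₂ → nonterminals vs ≡ nonterminals vs₂
  nonterminals-prefix []ᵥ       []ᵥ         _ = refl
  nonterminals-prefix (_ ∷ᵥ vs) (_ ∷ᵥ vs₂) e =
    cong₂ _∷_ (∷-injectiveˡ e) (nonterminals-prefix vs vs₂ (∷-injectiveʳ e))

  grow-handles-unique :
    ∀ u u₂ {A A₂ r r₂ a b} (vs : Vec (Tree ar) (arity a)) (vs₂ : Vec (Tree ar) (arity b)) {q q₂} →
    Rightmost (u ++ nt A ∷ r) → Rightmost (u₂ ++ nt A₂ ∷ r₂) →
    u ++ rhs a vs ++ terms ar Y q ≡ u₂ ++ rhs b vs₂ ++ terms ar Y q₂ →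
    u ≡ u₂ × rhs a vs ≡ rhs b vs₂
  grow-handles-unique [] [] vs vs₂ _ _ e with ∷-injectiveˡ e
  ... | refl = refl , cong (_ ∷_) (nonterminals-prefix vs vs₂ (∷-injectiveʳ e))
  grow-handles-unique [] (c ∷ u₂) vs vs₂ _ p₂ e with ∷-injectiveˡ e
  ... | refl = ⊥-elim (nonterminals-then-terminal vs u₂ (proj₁ p₂) (∷-injectiveʳ e))
  grow-handles-unique (c ∷ u) [] vs vs₂ p _ e with ∷-injectiveˡ e
  ... | refl = ⊥-elim (nonterminals-then-terminal vs₂ u (proj₁ p) (sym (∷-injectiveʳ e)))
  grow-handles-unique (c ∷ u) (_ ∷ u₂) vs vs₂ p p₂ e with ∷-injectiveˡ e
  ... | refl = map₁ (cong (c ∷_)) (grow-handles-unique u u₂ vs vs₂ (rightmost-tail c p) (rightmost-tail c p₂)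
                                                      (∷-injectiveʳ e))

  handles-unique : ∀ u u₂ {A A₂ h h₂ q q₂ q′} →
    RightmostForm (u ++ nt A ∷ terms ar Y q) → RightmostForm (u₂ ++ nt A₂ ∷ terms ar Y q₂) →
    Handle A h → Handle A₂ h₂ →
    u₂ ++ h₂ ++ terms ar Y q₂ ≡ u ++ h ++ terms ar Y q′ → u₂ ≡ u × h₂ ≡ h
  handles-unique u u₂ p p₂ (start _) (start _) e with start-form u p | start-form u₂ p₂
  ... | refl , refl | refl , refl with ∷-injectiveˡ e
  ...   | refl = refl , refl
  handles-unique u [] p _ (start _) (grow _ _ _) e with start-form u p
  ... | refl , refl with e
  ...   | ()
  handles-unique u (c ∷ u₂) p p₂ (start _) (grow _ _ _) e with start-form u p
  ... | refl , refl with ∷-injectiveˡ e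
  ...   | refl = ⊥-elim (¬terminal-++-nt u₂ (Derived.head-alone (derived-T (c ∷ u₂) p₂)))
  handles-unique [] u₂ _ p₂ (grow _ _ _) (start _) e with start-form u₂ p₂
  ... | refl , refl with e
  ...   | ()
  handles-unique (_ ∷ u) u₂ _ p₂ (grow _ _ _) (start _) e with start-form u₂ p₂
  ... | refl , refl with ++-conicalʳ u _ (sym (∷-injectiveʳ e))
  ...   | ()
  handles-unique u u₂ p p₂ (grow _ _ vs) (grow _ _ vs₂) e =
    grow-handles-unique u₂ u vs₂ vs (Derived.rightmost (derived-T u₂ p₂))
                                    (Derived.rightmost (derived-T u p)) e

lemma4p6 : (d m : ℕ) (ar : Fin m → ℕ) → 0 < d → (∀ i → 1 ≤ ar i × ar i ≤ d) →
           (Y : List (Tree ar)) →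
           ∀ (u h : SF ar Y) (q : List (Sym ar)) →
           HandleOcc ar Y u h q → Forced ar Y u h
lemma4p6 _ _ _ _ _ _ u h q (_ , _ , _ , derivation , rule , _)
         q′ u₂ h₂ q₂ e (_ , _ , _ , derivation₂ , rule₂ , _) =
  handles-unique u u₂ (rightmostForm-reachable derivation) (rightmostForm-reachable derivation₂)
                 (handle rule) (handle rule₂) e
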